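{- Let $\forall\overline{p}\,\Gamma/^{2}\phi$ be a $\Pi_2$-rule, where $\overline{p}=(p_1,\dots,p_n)$, and let $C=\{p_1,\dots,p_n\}$. Then $\forall\overline{p}\,\Gamma/^{2}\phi$ is admissible over $\vdash_S$ if and only if for every $C$-invariant substitution $\sigma$ such that $\vdash_S\sigma(\Gamma)$, we also have $\vdash_S\sigma(\phi)$.
   Context: Let $\mathcal{L}$ be a functional signature containing at least one constant symbol, and $Fm_{\mathcal{L}}$ the set of $\mathcal{L}$-formulas (terms) over a countably infinite set of propositional variables. A logic $\vdash\subseteq\wp(Fm_{\mathcal{L}})\times Fm_{\mathcal{L}}$ satisfies identity, monotonicity, transitivity, structurality (invariance under substitutions) and finitarity; $\Gamma\vdash\Delta$ means $\Gamma\vdash\psi$ for all $\psi\in\Delta$. The logic $\vdash$ is assumed strongly algebraizable (algebraizable with equivalent algebraic semantics a variety). Tuples of variables $\overline p$ consist of distinct variables; in $\phi(\overline p,\overline q)$ the tuples are disjoint and the variables of $\phi$ are among them. A $\Pi_2$-rule $\forall\overline{p}\,\Gamma/^2\psi$ is given by a finite set of formulas $\Gamma=\{\phi_0(\overline p,\overline q),\dots,\phi_k(\overline p,\overline q)\}$ and a formula $\psi(\overline q)$ (so the bound variables $\overline p$ do not occur in $\psi$); if $\overline p$ is empty it is a standard rule. Fix a Hilbert-style derivation system $\vdash_S$ for $\vdash$ (e.g. axioms all $\psi$ with $\emptyset\vdash\psi$, rules all $\Delta/\psi$ with $\Delta$ finite and $\Delta\vdash\psi$). For a set $\Sigma$ of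 $\Pi_2$-rules, $\vdash_{S\oplus\Sigma}\chi$ means there is a sequence $\psi_0,\dots,\psi_m=\chi$ in which each $\psi_i$ is an instance of an axiom of $S$, or is obtained by a rule of $S$ from earlier members, or $\psi_i=\chi'(\overline\xi/\overline q)$ where $\forall\overline p\,\{\mu_0(\overline p,\overline q),\dots,\mu_l(\overline p,\overline q)\}/^2\chi'(\overline q)\in\Sigma$ and every $\mu_j(\overline r/\overline p,\overline\xi/\overline q)$ occurs earlier in the sequence, $\overline r$ being a tuple of fresh variables not occurring in $\overline\xi$. A $\Pi_2$-rule $R$ is admissible in $\vdash_{S\oplus\Sigma}$ if for all formulas $\chi$, $\vdash_{S\oplus\Sigma\oplus R}\chi$ implies $\vdash_{S\oplus\Sigma}\chi$; admissible over $\vdash_S$ means admissible in $\vdash_{S\oplus\emptyset}=\vdash_S$. For a finite set $C$ of variables, a substitution $\sigma$ is $C$-invariant if $\sigma(p)=p$ for $p\in C$ and for every variable $q\notin C$ the formula $\sigma(q)$ contains no variable of $C$. -}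

module Defs where

open import Data.Nat using (ℕ; zero; suc)
open import Data.Vec using (Vec; []; _∷_)
open import Data.List using (List; []; _∷_; _++_; map)
open import Data.List.Membership.Propositional using (_∈_; _∉_)
open import Data.List.Relation.Unary.All using (All)
open import Data.List.Relation.Unary.Unique.Propositional using (Unique)
open import Data.Product using (Σ; ∃; _×_; _,_; proj₁; proj₂)
open import Data.Sum using (_⊎_)
open import Data.Empty using (⊥)
open import Relation.Binary.PropositionalEquality using (_≡_)
open import Relation.Nullary using (¬_)

record Signature : Set₁ where
  field
    Op       : Set
    arity    : Op → ℕ
    constant : Σ Op (λ c → arity c ≡ 0)

data Fm (L : Signature) : Set where
  var : ℕ → Fm L
  app : (f : Signature.Op L) → Vec (Fm L) (Signature.arity L f) → Fm L

_⇔_ : Set₁ → Set₁ → Set₁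
A ⇔ B = (A → B) × (B → A)

_⇔₀_ : Set → Set → Set
A ⇔₀ B = (A → B) × (B → A)

module _ {L : Signature} where
  open Signature L

  Subst : Set
  Subst = ℕ → Fm L

  mutual
    sub : Subst → Fm L → Fm L
    sub σ (var x)    = σ x
    sub σ (app f ts) = app f (subs σ ts)

    subs : ∀ {n} → Subst → Vec (Fm L) n → Vec (Fm L) n
    subs σ []       = []
    subs σ (t ∷ ts) = sub σ t ∷ subs σ ts

  mutual
    data _occ_ (x : ℕ) : Fm L → Set where
      here  : x occ var x
      there : ∀ {f ts} → x occs ts → x occ app f ts

    data _occs_ (x : ℕ) : ∀ {n} → Vec (Fm L) n → Set where
      hd : ∀ {n t} {ts : Vec (Fm L) n} → x occ t → x occs (t ∷ ts)
      tl : ∀ {n t} {ts : Vec (Fm L) n} → x occs ts → x occs (t ∷ ts)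

  VarsAmong : List ℕ → Fm L → Set
  VarsAmong xs φ = ∀ x → x occ φ → x ∈ xs

  Cons : Set₁
  Cons = (Fm L → Set) → Fm L → Set

  record IsLogic (⊢ : Cons) : Set₁ where
    field
      identity      : ∀ {Γ φ} → Γ φ → ⊢ Γ φ
      monotonicity  : ∀ {Γ Δ φ} → (∀ ψ → Γ ψ → Δ ψ) → ⊢ Γ φ → ⊢ Δ φ
      transitivity  : ∀ {Γ Δ φ} → (∀ ψ → Δ ψ → ⊢ Γ ψ) → ⊢ Δ φ → ⊢ Γ φ
      structurality : ∀ {Γ φ} (σ : Subst) → ⊢ Γ φ →
                      ⊢ (λ ψ → ∃ λ χ → Γ χ × ψ ≡ sub σ χ) (sub σ φ)
      finitarity    : ∀ {Γ φ} → ⊢ Γ φ →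
                      ∃ λ (Δ : List (Fm L)) → All Γ Δ × ⊢ (_∈ Δ) φ

  Eqn : Set
  Eqn = Fm L × Fm L

  record Algebra : Set₁ where
    field
      Carrier : Set
      op      : (f : Op) → Vec Carrier (arity f) → Carrier

  module _ (A : Algebra) where
    open Algebra A
    mutual
      eval : (ℕ → Carrier) → Fm L → Carrier
      eval v (var x)    = v x
      eval v (app f ts) = op f (evals v ts)

      evals : ∀ {n} → (ℕ → Carrier) → Vec (Fm L) n → Vec Carrier n
      evals v []       = []
      evals v (t ∷ ts) = eval v t ∷ evals v ts

    Holds : Eqn → (ℕ → Carrier) → Set
    Holds e v = eval v (proj₁ e) ≡ eval v (proj₂ e)

  Models : Algebra → (Eqn → Set) → Set
  Models A E = ∀ e → E e → ∀ v → Holds A e v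

  EqCons : (Eqn → Set) → (Eqn → Set) → Eqn → Set₁
  EqCons E Θ e = ∀ (A : Algebra) → Models A E → ∀ v →
                 (∀ e' → Θ e' → Holds A e' v) → Holds A e v

  at0 : Fm L → Subst
  at0 φ zero    = φ
  at0 φ (suc n) = var (suc n)

  τ[_] : List Eqn → Fm L → List Eqn
  τ[ τ ] φ = map (λ e → sub (at0 φ) (proj₁ e) , sub (at0 φ) (proj₂ e)) τ

  -- ⊢ is algebraizable with equivalent algebraic semantics a variety
  -- Mod(E), defining equations τ(p) (p = variable 0) and equivalence
  -- formulas Δ(p,q) (p,q = variables 0,1).
  StronglyAlgebraizable : Cons → Set₁
  StronglyAlgebraizable ⊢ =
    Σ (Eqn → Set) λ E → Σ (List Eqn) λ τ → Σ (List (Fm L)) λ Δ →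
      All (λ e → VarsAmong (0 ∷ []) (proj₁ e) × VarsAmong (0 ∷ []) (proj₂ e)) τ
    × All (VarsAmong (0 ∷ 1 ∷ [])) Δ
    × (∀ Γ φ → (⊢ Γ φ → ∀ e → e ∈ τ[ τ ] φ →
                   EqCons E (λ e' → ∃ λ ψ → Γ ψ × e' ∈ τ[ τ ] ψ) e)
             × ((∀ e → e ∈ τ[ τ ] φ →
                   EqCons E (λ e' → ∃ λ ψ → Γ ψ × e' ∈ τ[ τ ] ψ) e) → ⊢ Γ φ))
    × (∀ δ → δ ∈ Δ → ∀ e → e ∈ τ[ τ ] δ → EqCons E (_≡ (var 0 , var 1)) e)
    × EqCons E (λ e → ∃ λ δ → δ ∈ Δ × e ∈ τ[ τ ] δ) (var 0 , var 1)

  record Hilbert : Set₁ where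
    field
      Axiom : Fm L → Set
      Rule  : List (Fm L) → Fm L → Set

  record Pi2Rule : Set where
    field
      bound     : List ℕ
      free      : List ℕ
      boundUniq : Unique bound
      freeUniq  : Unique free
      disjoint  : ∀ x → x ∈ bound → x ∉ free
      prem      : List (Fm L)
      concl     : Fm L
      premVars  : All (VarsAmong (bound ++ free)) prem
      conclVars : VarsAmong free concl
  open Pi2Rule public

  IsPi2Inst : Pi2Rule → Subst → Set
  IsPi2Inst R θ =
      (∀ p → p ∈ bound R → ∃ λ r → θ p ≡ var r)
    × (∀ p p' → p ∈ bound R → p' ∈ bound R → θ p ≡ θ p' → p ≡ p')
    × (∀ p q r → p ∈ bound R → q ∈ free R → θ p ≡ var r → ¬ (r occ θ q))

  module _ (S : Hilbert) (Σr : Pi2Rule → Set) (H : Fm L → Set) where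
    open Hilbert S

    data Justified (earlier : List (Fm L)) : Fm L → Set where
      hyp  : ∀ {φ} → H φ → Justified earlier φ
      ax   : ∀ {φ} (σ : Subst) → Axiom φ → Justified earlier (sub σ φ)
      rule : ∀ {Δ φ} (σ : Subst) → Rule Δ φ →
             All (λ μ → sub σ μ ∈ earlier) Δ → Justified earlier (sub σ φ)
      pi2  : ∀ {R} (θ : Subst) → Σr R → IsPi2Inst R θ →
             All (λ μ → sub θ μ ∈ earlier) (prem R) →
             Justified earlier (sub θ (concl R))

    -- sequences, stored latest-first
    data Valid : List (Fm L) → Set where
      []  : Valid []
      _▸_ : ∀ {ψs ψ} → Valid ψs → Justified ψs ψ → Valid (ψ ∷ ψs)

    Derives : Fm L → Set
    Derives χ = ∃ λ ψs → Valid (χ ∷ ψs)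

  NoRules : Pi2Rule → Set
  NoRules _ = ⊥

  _⊕_ : (Pi2Rule → Set) → Pi2Rule → Pi2Rule → Set
  (Σr ⊕ R) R' = Σr R' ⊎ R' ≡ R

  Thm : Hilbert → (Pi2Rule → Set) → Fm L → Set
  Thm S Σr χ = Derives S Σr (λ _ → ⊥) χ

  IsHilbertFor : Hilbert → Cons → Set₁
  IsHilbertFor S ⊢ = ∀ Γ φ → ⊢ Γ φ ⇔₀ Derives S NoRules Γ φ

  AdmissibleIn : Hilbert → (Pi2Rule → Set) → Pi2Rule → Set
  AdmissibleIn S Σr R = ∀ χ → Thm S (Σr ⊕ R) χ → Thm S Σr χ

  AdmissibleOver : Hilbert → Pi2Rule → Set
  AdmissibleOver S R = AdmissibleIn S NoRules R

  CInvariant : List ℕ → Subst → Set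
  CInvariant C σ = (∀ p → p ∈ C → σ p ≡ var p)
                 × (∀ q → q ∉ C → ∀ p → p ∈ C → ¬ (p occ σ q))

-- A Π₂-rule R is admissible over S exactly when the theorems of S are
-- closed under every instance θ of R, and it suffices to check C-invariant
-- instances.  An instance θ sends the bound variables p̄ to distinct fresh
-- variables r̄; let τ rename r̄ back to p̄ and shift every other variable x
-- to x + N, above C.  Then σ := τ ∘ θ on the free variables (identity
-- elsewhere) is C-invariant, σ(Γ) = τ(θ(Γ)), and θ(φ) = τ⁻(σ(φ)) for the
-- inverse shift τ⁻, because the r̄ do not occur in θ(q̄).  Since theorems of
-- S are closed under substitution, the C-invariant case gives the general
-- one.
module Submission where

open import Defs
open import Function using (_∘_)
open import Data.Nat using (ℕ; suc; _+_; _∸_; _<_; _≟_; s≤s)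
open import Data.Nat.Properties using (m+n∸n≡m; m≤n+m; <-≤-trans; <-irrefl)
open import Data.List using (List; []; _∷_; _++_)
open import Data.List.Extrema.Nat using (max; xs≤max)
open import Data.List.Membership.Propositional using (_∈_; _∉_; find; lose)
open import Data.List.Membership.Propositional.Properties using (∈-++⁺ˡ; ∈-++⁺ʳ; ∈-++⁻)
open import Data.List.Membership.DecPropositional _≟_ using (_∈?_)
open import Data.List.Relation.Unary.All as All using (All; []; _∷_)
open import Data.List.Relation.Unary.Any using (Any; here; any?)
open import Data.Vec using (Vec; []; _∷_)
open import Data.Product using (∃; _×_; _,_; proj₁; proj₂)
open import Data.Sum using (inj₁; inj₂)
open import Data.Empty using (⊥-elim)
open import Relation.Nullary using (¬_; Dec; yes; no)
open import Relation.Binary.PropositionalEquality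
  using (_≡_; _≢_; refl; sym; trans; cong; cong₂; subst; module ≡-Reasoning)

module _ {L : Signature} where

  mutual
    sub-∘ : (τ σ : Subst {L}) (φ : Fm L) → sub τ (sub σ φ) ≡ sub (sub τ ∘ σ) φ
    sub-∘ τ σ (var x)    = refl
    sub-∘ τ σ (app f ts) = cong (app f) (subs-∘ τ σ ts)

    subs-∘ : ∀ {n} (τ σ : Subst {L}) (ts : Vec (Fm L) n) →
             subs τ (subs σ ts) ≡ subs (sub τ ∘ σ) ts
    subs-∘ τ σ []       = refl
    subs-∘ τ σ (t ∷ ts) = cong₂ _∷_ (sub-∘ τ σ t) (subs-∘ τ σ ts)

  mutual
    sub-cong : {σ σ' : Subst {L}} (φ : Fm L) →
               (∀ x → x occ φ → σ x ≡ σ' x) → sub σ φ ≡ sub σ' φ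
    sub-cong (var x)    eq = eq x here
    sub-cong (app f ts) eq = cong (app f) (subs-cong ts (λ x → eq x ∘ there))

    subs-cong : ∀ {n} {σ σ' : Subst {L}} (ts : Vec (Fm L) n) →
                (∀ x → x occs ts → σ x ≡ σ' x) → subs σ ts ≡ subs σ' ts
    subs-cong []       eq = refl
    subs-cong (t ∷ ts) eq =
      cong₂ _∷_ (sub-cong t (λ x → eq x ∘ hd)) (subs-cong ts (λ x → eq x ∘ tl))

  mutual
    sub-var : (φ : Fm L) → sub var φ ≡ φ
    sub-var (var x)    = refl
    sub-var (app f ts) = cong (app f) (subs-var ts)

    subs-var : ∀ {n} (ts : Vec (Fm L) n) → subs var ts ≡ ts
    subs-var []       = refl
    subs-var (t ∷ ts) = cong₂ _∷_ (sub-var t) (subs-var ts)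

  mutual
    occ-sub⁻ : (σ : Subst {L}) (φ : Fm L) {p : ℕ} →
               p occ sub σ φ → ∃ λ x → x occ φ × p occ σ x
    occ-sub⁻ σ (var x)    p∈σx      = x , here , p∈σx
    occ-sub⁻ σ (app f ts) (there o) with occs-sub⁻ σ ts o
    ... | x , x∈ts , p∈σx = x , there x∈ts , p∈σx

    occs-sub⁻ : ∀ {n} (σ : Subst {L}) (ts : Vec (Fm L) n) {p : ℕ} →
                p occs subs σ ts → ∃ λ x → x occs ts × p occ σ x
    occs-sub⁻ σ (t ∷ ts) (hd o) with occ-sub⁻ σ t o
    ... | x , x∈t , p∈σx = x , hd x∈t , p∈σx
    occs-sub⁻ σ (t ∷ ts) (tl o) with occs-sub⁻ σ ts o
    ... | x , x∈ts , p∈σx = x , tl x∈ts , p∈σx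

  occ-var⁻ : ∀ {p x} → p occ var {L} x → p ≡ x
  occ-var⁻ here = refl

  var-injective : ∀ {x y} → var {L} x ≡ var y → x ≡ y
  var-injective refl = refl

  -- Junk value 0 on non-variables.
  varIndex : Fm L → ℕ
  varIndex (var x)   = x
  varIndex (app _ _) = 0

  SubstClosed : (Fm L → Set) → Set
  SubstClosed T = ∀ (τ : Subst) {χ} → T χ → T (sub τ χ)

  InstanceClosed : (Fm L → Set) → Pi2Rule → Set
  InstanceClosed T R = ∀ θ → IsPi2Inst R θ →
    All (λ μ → T (sub θ μ)) (prem R) → T (sub θ (concl R))

  CInvariant⇒IsPi2Inst : ∀ R {σ} → CInvariant (bound R) σ → IsPi2Inst R σ
  CInvariant⇒IsPi2Inst R {σ} (σp≡p , p∉σq) =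
      (λ p p∈C → p , σp≡p p p∈C)
    , (λ p p' p∈C p'∈C σp≡σp' →
         var-injective (trans (sym (σp≡p p p∈C)) (trans σp≡σp' (σp≡p p' p'∈C))))
    , λ p q r p∈C q∈F σp≡r r∈σq →
         p∉σq q (λ q∈C → disjoint R q q∈C q∈F) p p∈C
           (subst (_occ σ q) (var-injective (trans (sym σp≡r) (σp≡p p p∈C))) r∈σq)

  Thm-substClosed : ∀ {⊢ : Cons {L}} {S} → IsLogic ⊢ → IsHilbertFor S ⊢ →
                    SubstClosed (Thm S NoRules)
  Thm-substClosed logic hilbert τ d =
    proj₁ (hilbert _ _)
      (monotonicity (λ { _ (_ , () , _) }) (structurality τ (proj₂ (hilbert _ _) d)))
    where open IsLogic logic

  module _ {S : Hilbert {L}} {H : Fm L → Set} where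

    Justified-weaken : ∀ {Σr ψs ψs' φ} → Justified S Σr H ψs φ →
                       Justified S Σr H (ψs ++ ψs') φ
    Justified-weaken (hyp h)        = hyp h
    Justified-weaken (ax σ a)       = ax σ a
    Justified-weaken (rule σ r ms)  = rule σ r (All.map ∈-++⁺ˡ ms)
    Justified-weaken (pi2 θ r i ms) = pi2 θ r i (All.map ∈-++⁺ˡ ms)

    Valid-++ : ∀ {Σr ψs ψs'} → Valid S Σr H ψs → Valid S Σr H ψs' →
               Valid S Σr H (ψs ++ ψs')
    Valid-++ []      v' = v'
    Valid-++ (v ▸ j) v' = Valid-++ v v' ▸ Justified-weaken j

    Derives-gather : ∀ {Σr} (f : Fm L → Fm L) {μs : List (Fm L)} →
                     All (Derives S Σr H ∘ f) μs →
                     ∃ λ ψs → Valid S Σr H ψs × All (λ μ → f μ ∈ ψs) μs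
    Derives-gather f []              = [] , [] , []
    Derives-gather f ((ψs , v) ∷ ds) with Derives-gather f ds
    ... | ψs' , v' , ms =
      (_ ∷ ψs) ++ ψs' , Valid-++ v v' , here refl ∷ All.map (∈-++⁺ʳ (_ ∷ ψs)) ms

    Derives-instanceClosed : ∀ {Σr R} → Σr R → InstanceClosed (Derives S Σr H) R
    Derives-instanceClosed r θ θ-inst ds with Derives-gather (sub θ) ds
    ... | ψs , v , ms = ψs , v ▸ pi2 θ r θ-inst ms

    module _ {Σr Σr' : Pi2Rule → Set}
             (closed : ∀ {R} → Σr R → InstanceClosed (Derives S Σr' H) R) where

      Justified-derivable : ∀ {ψs ψ} → All (Derives S Σr' H) ψs →
                            Justified S Σr H ψs ψ → Derives S Σr' H ψ
      Justified-derivable ds (hyp h)  = [] , [] ▸ hyp h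
      Justified-derivable ds (ax σ a) = [] , [] ▸ ax σ a
      Justified-derivable ds (rule σ r ms)
        with Derives-gather (sub σ) (All.map (All.lookup ds) ms)
      ... | ψs , v , ms' = ψs , v ▸ rule σ r ms'
      Justified-derivable ds (pi2 θ r θ-inst ms) =
        closed r θ θ-inst (All.map (All.lookup ds) ms)

      Valid⇒Derives : ∀ {ψs} → Valid S Σr H ψs → All (Derives S Σr' H) ψs
      Valid⇒Derives []      = []
      Valid⇒Derives (v ▸ j) = Justified-derivable (Valid⇒Derives v) j ∷ Valid⇒Derives v

      Derives-transfer : ∀ {χ} → Derives S Σr H χ → Derives S Σr' H χ
      Derives-transfer (_ , v) = All.head (Valid⇒Derives v)

  AdmissibleIn⇔InstanceClosed : ∀ S Σr R →
    AdmissibleIn S Σr R ⇔₀ InstanceClosed (Thm S Σr) R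
  AdmissibleIn⇔InstanceClosed S Σr R = admissible⇒closed , closed⇒admissible
    where
    admissible⇒closed : AdmissibleIn S Σr R → InstanceClosed (Thm S Σr) R
    admissible⇒closed admissible θ θ-inst ds =
      admissible _ (Derives-instanceClosed (inj₂ refl) θ θ-inst
        (All.map (Derives-transfer (Derives-instanceClosed ∘ inj₁)) ds))

    closed⇒admissible : InstanceClosed (Thm S Σr) R → AdmissibleIn S Σr R
    closed⇒admissible closed χ = Derives-transfer λ
      { (inj₁ r)    → Derives-instanceClosed r
      ; (inj₂ refl) → closed }

  module RenamingApart (R : Pi2Rule {L}) {θ : Subst {L}} (θ-inst : IsPi2Inst R θ) where
    open ≡-Reasoning

    r : ℕ → ℕ
    r p = varIndex (θ p)

    θ-bound : ∀ {p} → p ∈ bound R → θ p ≡ var (r p)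
    θ-bound {p} p∈C with proj₁ θ-inst p p∈C
    ... | _ , θp≡var rewrite θp≡var = refl

    r-injective : ∀ {p p'} → p ∈ bound R → p' ∈ bound R → r p ≡ r p' → p ≡ p'
    r-injective p∈C p'∈C rp≡rp' = proj₁ (proj₂ θ-inst) _ _ p∈C p'∈C
      (trans (θ-bound p∈C) (trans (cong var rp≡rp') (sym (θ-bound p'∈C))))

    Fresh : ℕ → Set
    Fresh x = ∀ {p} → p ∈ bound R → r p ≢ x

    fresh-in-free : ∀ {q x} → q ∈ free R → x occ θ q → Fresh x
    fresh-in-free q∈F x∈θq p∈C refl =
      proj₂ (proj₂ θ-inst) _ _ _ p∈C q∈F (θ-bound p∈C) x∈θq

    N : ℕ
    N = suc (max 0 (bound R))

    bound<N : ∀ {p} → p ∈ bound R → p < N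
    bound<N p∈C = s≤s (All.lookup (xs≤max 0 (bound R)) p∈C)

    rename : (x : ℕ) → Dec (Any (λ p → r p ≡ x) (bound R)) → Fm L
    rename x (yes r⁻¹x) = var (proj₁ (find r⁻¹x))
    rename x (no _)     = var (x + N)

    τ : Subst {L}
    τ x = rename x (any? (λ p → r p ≟ x) (bound R))

    τ⁻ : Subst {L}
    τ⁻ y = var (y ∸ N)

    τ-r : ∀ {p} → p ∈ bound R → τ (r p) ≡ var p
    τ-r {p} p∈C with any? (λ p' → r p' ≟ r p) (bound R)
    ... | yes r⁻¹rp = let (_ , p'∈C , rp'≡rp) = find r⁻¹rp in
                      cong var (r-injective p'∈C p∈C rp'≡rp)
    ... | no ¬r⁻¹rp = ⊥-elim (¬r⁻¹rp (lose p∈C refl))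

    τ-fresh : ∀ {x} → Fresh x → τ x ≡ var (x + N)
    τ-fresh {x} fresh with any? (λ p → r p ≟ x) (bound R)
    ... | yes r⁻¹x = let (_ , p∈C , rp≡x) = find r⁻¹x in ⊥-elim (fresh p∈C rp≡x)
    ... | no _     = refl

    τ⁻-τ-fresh : ∀ {x} → Fresh x → sub τ⁻ (τ x) ≡ var x
    τ⁻-τ-fresh {x} fresh rewrite τ-fresh fresh = cong var (m+n∸n≡m x N)

    bound∉τ-fresh : ∀ {x p} → Fresh x → p ∈ bound R → ¬ (p occ τ x)
    bound∉τ-fresh {x} fresh p∈C p∈τx rewrite τ-fresh fresh with occ-var⁻ p∈τx
    ... | refl = <-irrefl refl (<-≤-trans (bound<N p∈C) (m≤n+m N x))

    τ⁻-τ-θ : ∀ {q} → q ∈ free R → sub τ⁻ (sub τ (θ q)) ≡ θ q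
    τ⁻-τ-θ {q} q∈F = begin
      sub τ⁻ (sub τ (θ q))   ≡⟨ sub-∘ τ⁻ τ (θ q) ⟩
      sub (sub τ⁻ ∘ τ) (θ q) ≡⟨ sub-cong (θ q) (λ _ → τ⁻-τ-fresh ∘ fresh-in-free q∈F) ⟩
      sub var (θ q)          ≡⟨ sub-var (θ q) ⟩
      θ q                    ∎

    extend : (x : ℕ) → Dec (x ∈ free R) → Fm L
    extend x (yes _) = sub τ (θ x)
    extend x (no _)  = var x

    σ : Subst {L}
    σ x = extend x (x ∈? free R)

    σ-free : ∀ {q} → q ∈ free R → σ q ≡ sub τ (θ q)
    σ-free {q} q∈F with q ∈? free R
    ... | yes _   = refl
    ... | no q∉F = ⊥-elim (q∉F q∈F)

    σ-nonfree : ∀ {x} → x ∉ free R → σ x ≡ var x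
    σ-nonfree {x} x∉F with x ∈? free R
    ... | yes x∈F = ⊥-elim (x∉F x∈F)
    ... | no _    = refl

    σ-CInvariant : CInvariant (bound R) σ
    σ-CInvariant = (λ p p∈C → σ-nonfree (disjoint R p p∈C)) , bound∉σ
      where
      bound∉σ : ∀ q → q ∉ bound R → ∀ p → p ∈ bound R → ¬ (p occ σ q)
      bound∉σ q q∉C p p∈C p∈σq with q ∈? free R
      ... | yes q∈F =
        let (x , x∈θq , p∈τx) = occ-sub⁻ τ (θ q) p∈σq
        in bound∉τ-fresh (fresh-in-free q∈F x∈θq) p∈C p∈τx
      ... | no _ = q∉C (subst (_∈ bound R) (occ-var⁻ p∈σq) p∈C)

    σ-premise : ∀ {μ} → VarsAmong (bound R ++ free R) μ → sub σ μ ≡ sub τ (sub θ μ)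
    σ-premise {μ} vars = trans (sub-cong μ σ≡τ∘θ) (sym (sub-∘ τ θ μ))
      where
      σ≡τ∘θ : ∀ x → x occ μ → σ x ≡ sub τ (θ x)
      σ≡τ∘θ x x∈μ with ∈-++⁻ (bound R) (vars x x∈μ)
      ... | inj₂ x∈F = σ-free x∈F
      ... | inj₁ x∈C = begin
        σ x             ≡⟨ σ-nonfree (disjoint R x x∈C) ⟩
        var x           ≡⟨ τ-r x∈C ⟨
        τ (r x)         ≡⟨ cong (sub τ) (θ-bound x∈C) ⟨
        sub τ (θ x)     ∎

    θ-conclusion : sub θ (concl R) ≡ sub τ⁻ (sub σ (concl R))
    θ-conclusion = trans (sub-cong (concl R) θ≡τ⁻∘σ) (sym (sub-∘ τ⁻ σ (concl R)))
      where
      θ≡τ⁻∘σ : ∀ x → x occ concl R → θ x ≡ sub τ⁻ (σ x)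
      θ≡τ⁻∘σ x x∈φ = begin
        θ x                  ≡⟨ τ⁻-τ-θ (conclVars R x x∈φ) ⟨
        sub τ⁻ (sub τ (θ x)) ≡⟨ cong (sub τ⁻) (σ-free (conclVars R x x∈φ)) ⟨
        sub τ⁻ (σ x)         ∎

  CInvariantClosed⇒InstanceClosed : ∀ {T} R → SubstClosed T →
    ((σ : Subst) → CInvariant (bound R) σ →
      All (λ μ → T (sub σ μ)) (prem R) → T (sub σ (concl R))) →
    InstanceClosed T R
  CInvariantClosed⇒InstanceClosed {T} R T-sub closed θ θ-inst ds =
    subst T (sym θ-conclusion) (T-sub τ⁻ (closed σ σ-CInvariant premises))
    where
    open RenamingApart R θ-inst
    premises : All (λ μ → T (sub σ μ)) (prem R)
    premises = All.zipWith (λ (vars , d) → subst T (sym (σ-premise vars)) (T-sub τ d))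
                           (premVars R , ds)

  lemma2p8 : (⊢ : Cons {L}) → IsLogic ⊢ → StronglyAlgebraizable ⊢ →
    (S : Hilbert) → IsHilbertFor S ⊢ → (R : Pi2Rule) →
    AdmissibleOver S R ⇔₀
      ((σ : Subst) → CInvariant (bound R) σ →
        All (λ μ → Thm S NoRules (sub σ μ)) (prem R) →
        Thm S NoRules (sub σ (concl R)))
  lemma2p8 ⊢ logic _ S hilbert R =
      (λ admissible σ σ-inv → admissible⇒closed admissible σ (CInvariant⇒IsPi2Inst R σ-inv))
    , (λ closed → closed⇒admissible
         (CInvariantClosed⇒InstanceClosed R (Thm-substClosed logic hilbert) closed))
    where
    admissible⇒closed : AdmissibleOver S R → InstanceClosed (Thm S NoRules) R
    admissible⇒closed = proj₁ (AdmissibleIn⇔InstanceClosed S NoRules R)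
    closed⇒admissible : InstanceClosed (Thm S NoRules) R → AdmissibleOver S R
    closed⇒admissible = proj₂ (AdmissibleIn⇔InstanceClosed S NoRules R)
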